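{- For any nominal substitution $\sigma$, freshness environments $\nabla_1$ and $\nabla_2$, and nominal term $t$ such that $\nabla_2\vdash\sigma(\nabla_1)$ and $\mathrm{Vars}(t)\subseteq\mathrm{Dom}(\sigma)$, we have $[\sigma]^{\nabla_1}_{\nabla_2}([t]_{\nabla_1})=[\sigma(t)]_{\nabla_2}$ (modulo $\alpha\beta\eta$).
   Context: Nominal setting. Atoms (each of a sort of atoms), variables $X$ with sorts, function symbols; nominal terms $t::=f(t_1,\dots,t_n)\mid a\mid a.t\mid\pi\cdot X$, with $\pi$ a permutation (finite sequence of swappings $(a\,b)$ of same-sort atoms, acting on atoms, and on terms homomorphically with $(a\,b)\cdot(c.t)=((a\,b)\cdot c).((a\,b)\cdot t)$, $\pi\cdot(\pi'\cdot X)=(\pi\pi')\cdot X$). $\mathrm{Vars}(t)$: variables of $t$. A nominal substitution $\sigma$ with domain $\mathrm{Dom}(\sigma)$ replaces variables without renaming, $\sigma(\pi\cdot X)=\pi\cdot\sigma(X)$. A freshness environment is a finite set of constraints $a\#X$. The judgment $\nabla\vdash a\#t$ is the least relation with: $\nabla\vdash a\#a'$ if $a\ne a'$; $\nabla\vdash a\#\pi\cdot X$ if $(\pi^{ -1}\cdot a)\#X\in\nabla$; $\nabla\vdash a\#f(\vec t)$ if all $\nabla\vdash a\#t_i$; $\nabla\vdash a\#a.t$; $\nabla\vdash a\#a'.t$ if $a\ne a'$ and $\nabla\vdash a\#t$. $\nabla_2\vdash\sigma(\nabla_1)$ means $\nabla_2\vdash a\#\sigma(X)$ for each $a\#X\in\nabla_1$.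 Translation (standing assumption: a fixed ordered list $\langle a_1,\dots,a_n\rangle$ of pairwise distinct atoms containing all atoms under consideration). Base types named by sorts, $[\nu]=\nu$, $[\delta]=\delta$, $[\langle\nu\rangle\tau]=\nu\to[\tau]$, $[\tau_1\times\cdots\times\tau_n\to\tau]=[\tau_1]\to\cdots\to[\tau_n]\to[\tau]$; atoms become $\lambda$-variables of the same name, function symbols constants. $[a]_\nabla=a$, $[f(t_1,\dots,t_n)]_\nabla=f([t_1]_\nabla,\dots)$, $[a.t]_\nabla=\lambda a.[t]_\nabla$, $[\pi\cdot X]_\nabla=X([\pi\cdot b_1]_\nabla,\dots,[\pi\cdot b_m]_\nabla)$ where $\langle b_1,\dots,b_m\rangle$ is the order-preserving sublist of $\langle a_1,\dots,a_n\rangle$ of atoms $a$ with $a\#X\notin\nabla$, and $X$ denotes the free $\lambda$-variable named $X$ of type $[\nu_1]\to\cdots\to[\nu_m]\to[\tau]$ ($\lambda$-variables are determined by name and type). For $\nabla,\nabla'$ with $\nabla\vdash\sigma(\nabla')$: $[\sigma]^{\nabla'}_{\nabla}=\bigcup_{X\in\mathrm{Dom}(\sigma)}[X\mapsto\lambda b_1.\cdots\lambda b_m.[\sigma(X)]_\nabla]$ where $\langle b_1,\dots,b_m\rangle$ is the order-preserving sublist of atoms $a$ of $\langle a_1,\dots,a_n\rangle$ with $a\#X\notin\nabla'$, and the replaced $X$ is the head variable of $[X]_{\nabla'}$. -}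

module Defs where

open import Data.Nat using (ℕ; zero; suc; _≡ᵇ_; _<ᵇ_)
open import Data.Nat.Properties using () renaming (_≟_ to _≟ℕ_)
open import Data.Bool using (Bool; true; false; if_then_else_)
open import Data.Maybe using (Maybe; just; nothing; maybe′)
import Data.Maybe as Maybe
open import Data.Product using (_×_; _,_)
open import Data.Product.Properties using (≡-dec)
open import Data.List using (List; []; _∷_; _++_; reverse; filter; length; map; foldl)
open import Data.List.Relation.Unary.All using (All)
open import Data.List.Membership.Propositional using (_∈_)
import Data.List.Membership.DecPropositional as DecMem
open import Relation.Nullary using (¬?)
open import Relation.Binary.PropositionalEquality using (_≡_; _≢_)
open import Function using (id)

Atom : Set
Atom = ℕ

Var : Set
Var = ℕ

FSym : Set
FSym = ℕ

-- a permutation is a finite list of swappings (a b);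
-- the head swapping is applied last: ((a b) ∷ π) · c = (a b) · (π · c)
Perm : Set
Perm = List (Atom × Atom)

swapA : Atom → Atom → Atom → Atom
swapA a b c = if c ≡ᵇ a then b else (if c ≡ᵇ b then a else c)

permA : Perm → Atom → Atom
permA [] c = c
permA ((a , b) ∷ π) c = swapA a b (permA π c)

inv : Perm → Perm
inv π = reverse π

data Term : Set where
  fn  : FSym → List Term → Term
  atm : Atom → Term
  abs : Atom → Term → Term
  sus : Perm → Var → Term

mutual
  permT : Perm → Term → Term
  permT π (fn f ts) = fn f (permTs π ts)
  permT π (atm a) = atm (permA π a)
  permT π (abs a t) = abs (permA π a) (permT π t)
  permT π (sus π' X) = sus (π ++ π') X

  permTs : Perm → List Term → List Term
  permTs π [] = []
  permTs π (t ∷ ts) = permT π t ∷ permTs π ts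

mutual
  varsT : Term → List Var
  varsT (fn f ts) = varsTs ts
  varsT (atm a) = []
  varsT (abs a t) = varsT t
  varsT (sus π X) = X ∷ []

  varsTs : List Term → List Var
  varsTs [] = []
  varsTs (t ∷ ts) = varsT t ++ varsTs ts

permAtoms : Perm → List Atom
permAtoms [] = []
permAtoms ((a , b) ∷ π) = a ∷ b ∷ permAtoms π

mutual
  atomsT : Term → List Atom
  atomsT (fn f ts) = atomsTs ts
  atomsT (atm a) = a ∷ []
  atomsT (abs a t) = a ∷ atomsT t
  atomsT (sus π X) = permAtoms π

  atomsTs : List Term → List Atom
  atomsTs [] = []
  atomsTs (t ∷ ts) = atomsT t ++ atomsTs ts

-- nominal substitutions: σ X ≡ just u means X ∈ Dom(σ) and σ(X) = u
Subst : Set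
Subst = Var → Maybe Term

mutual
  applyS : Subst → Term → Term
  applyS σ (fn f ts) = fn f (applySs σ ts)
  applyS σ (atm a) = atm a
  applyS σ (abs a t) = abs a (applyS σ t)
  applyS σ (sus π X) = maybe′ (permT π) (sus π X) (σ X)

  applySs : Subst → List Term → List Term
  applySs σ [] = []
  applySs σ (t ∷ ts) = applyS σ t ∷ applySs σ ts

-- freshness environments: (a , X) stands for a#X
FEnv : Set
FEnv = List (Atom × Var)

data _⊢_#_ (∇ : FEnv) : Atom → Term → Set where
  #atm  : ∀ {a a'} → a ≢ a' → ∇ ⊢ a # atm a'
  #sus  : ∀ {a π X} → (permA (inv π) a , X) ∈ ∇ → ∇ ⊢ a # sus π X
  #fn   : ∀ {a f ts} → All (λ t → ∇ ⊢ a # t) ts → ∇ ⊢ a # fn f ts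
  #abs= : ∀ {a t} → ∇ ⊢ a # abs a t
  #abs  : ∀ {a a' t} → a ≢ a' → ∇ ⊢ a # t → ∇ ⊢ a # abs a' t

_⊢σ_⟨_⟩ : FEnv → Subst → FEnv → Set
∇₂ ⊢σ σ ⟨ ∇₁ ⟩ = ∀ {a X} → (a , X) ∈ ∇₁ → ∇₂ ⊢ a # applyS σ (sus [] X)

-- λ-terms, locally nameless (α-equivalence classes):
-- bound variables as de Bruijn indices, atoms as free named variables,
-- the free λ-variable "X of arity m" as  mvar X m  (for fixed X its type
-- is determined by its arity), function symbols as constants.

data Λ : Set where
  bvar : ℕ → Λ
  fvar : Atom → Λ
  mvar : Var → ℕ → Λ
  con  : FSym → Λ
  app  : Λ → Λ → Λ
  lam  : Λ → Λ

apps : Λ → List Λ → Λ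
apps = foldl app

close : Atom → ℕ → Λ → Λ
close a d (bvar i) = bvar i
close a d (fvar c) = if c ≡ᵇ a then bvar d else fvar c
close a d (mvar X m) = mvar X m
close a d (con f) = con f
close a d (app M N) = app (close a d M) (close a d N)
close a d (lam M) = lam (close a (suc d) M)

lams : List Atom → Λ → Λ
lams [] M = M
lams (b ∷ bs) M = lam (close b 0 (lams bs M))

shift : ℕ → Λ → Λ
shift c (bvar i) = if i <ᵇ c then bvar i else bvar (suc i)
shift c (fvar a) = fvar a
shift c (mvar X m) = mvar X m
shift c (con f) = con f
shift c (app M N) = app (shift c M) (shift c N)
shift c (lam M) = lam (shift (suc c) M)

-- substitute N for index k (lifting N over k binders) and lower indices > k
sub-var : ℕ → ℕ → Λ → Λ
sub-var zero zero N = N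
sub-var zero (suc i) N = bvar i
sub-var (suc k) zero N = bvar zero
sub-var (suc k) (suc i) N = shift 0 (sub-var k i N)

sub : ℕ → Λ → Λ → Λ
sub k N (bvar i) = sub-var k i N
sub k N (fvar a) = fvar a
sub k N (mvar X m) = mvar X m
sub k N (con f) = con f
sub k N (app M M') = app (sub k N M) (sub k N M')
sub k N (lam M) = lam (sub (suc k) N M)

data _≈βη_ : Λ → Λ → Set where
  β       : ∀ {M N} → app (lam M) N ≈βη sub 0 N M
  η       : ∀ {M} → lam (app (shift 0 M) (bvar 0)) ≈βη M
  ≈refl   : ∀ {M} → M ≈βη M
  ≈sym    : ∀ {M N} → M ≈βη N → N ≈βη M
  ≈trans  : ∀ {M N P} → M ≈βη N → N ≈βη P → M ≈βη P
  app-cong : ∀ {M M' N N'} → M ≈βη M' → N ≈βη N' → app M N ≈βη app M' N'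
  lam-cong : ∀ {M M'} → M ≈βη M' → lam M ≈βη lam M'

MSubst : Set
MSubst = Var → ℕ → Maybe Λ

msub : MSubst → Λ → Λ
msub ρ (bvar i) = bvar i
msub ρ (fvar a) = fvar a
msub ρ (mvar X m) = maybe′ id (mvar X m) (ρ X m)
msub ρ (con f) = con f
msub ρ (app M N) = app (msub ρ M) (msub ρ N)
msub ρ (lam M) = lam (msub (λ X m → Maybe.map (shift 0) (ρ X m)) M)

open DecMem (≡-dec _≟ℕ_ _≟ℕ_) using (_∈?_)

nonFresh : List Atom → FEnv → Var → List Atom
nonFresh as ∇ X = filter (λ a → ¬? ((a , X) ∈? ∇)) as

mutual
  ⟦_⟧ : Term → List Atom → FEnv → Λ
  ⟦ fn f ts ⟧ as ∇ = apps (con f) (⟦ ts ⟧s as ∇)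
  ⟦ atm a ⟧ as ∇ = fvar a
  ⟦ abs a t ⟧ as ∇ = lam (close a 0 (⟦ t ⟧ as ∇))
  ⟦ sus π X ⟧ as ∇ =
    apps (mvar X (length (nonFresh as ∇ X)))
         (map (λ b → fvar (permA π b)) (nonFresh as ∇ X))

  ⟦_⟧s : List Term → List Atom → FEnv → List Λ
  ⟦ [] ⟧s as ∇ = []
  ⟦ t ∷ ts ⟧s as ∇ = ⟦ t ⟧ as ∇ ∷ ⟦ ts ⟧s as ∇

⟦_⟧σ : Subst → List Atom → FEnv → FEnv → MSubst
⟦ σ ⟧σ as ∇₁ ∇₂ X m with σ X
... | nothing = nothing
... | just u = if m ≡ᵇ length (nonFresh as ∇₁ X)
                 then just (lams (nonFresh as ∇₁ X) (⟦ u ⟧ as ∇₂))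
                 else nothing

-- Every image λb₁⋯λbₘ.[σ(X)]_{∇₂} of the meta-substitution is a closed
-- λ-term: an atom free in [σ(X)]_{∇₂} is not ∇₂-fresh for σ(X), hence (by ∇₂ ⊢ σ(∇₁)) not
-- ∇₁-fresh for X, i.e. it is one of the bᵢ. Closed images commute with λ-abstraction, which
-- settles the abstraction case. At a suspension π·X the instantiated term is
-- (λb⃗.[σ(X)]) (π·b⃗), the renaming by π of the redex (λb⃗.[σ(X)]) b⃗ ≈ [σ(X)]. Since the
-- translation commutes with permutations, [π·σ(X)] is the renaming by π of [σ(X)], and
-- βη-conversion is stable under renaming of free atoms.
module Submission where

open import Defs
open import Data.Bool using (true; false; T)
open import Data.Empty using (⊥-elim)
open import Data.List using (List; []; _∷_; _++_; length; map; [_])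
open import Data.List.Properties using (unfold-reverse; map-∘; map-cong)
open import Data.List.Membership.Propositional using (_∈_; _∉_; find)
open import Data.List.Membership.Propositional.Properties using (∈-++⁺ˡ; ∈-++⁺ʳ; ∈-filter⁺; ∈-filter⁻)
import Data.List.Membership.DecPropositional as DecMem
open import Data.List.Relation.Binary.Pointwise using (Pointwise; []; _∷_)
import Data.List.Relation.Binary.Pointwise as Pointwise
open import Data.List.Relation.Unary.All using (All; []; _∷_)
open import Data.List.Relation.Unary.Any using (Any; here; there)
open import Data.List.Relation.Unary.Any.Properties using (map⁻)
open import Data.List.Relation.Unary.Unique.Propositional using (Unique)
open import Data.Maybe using (just; nothing; maybe′)
import Data.Maybe as Maybe
open import Data.Nat using (ℕ; zero; suc; _+_; _≤_; _<_; z≤n; s≤s; _≡ᵇ_; _<ᵇ_)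
open import Data.Nat.Properties using (_≟_; <⇒<ᵇ; <ᵇ⇒<; <-≤-trans; <-irrefl; ≤-refl; m<n⇒m<1+n)
open import Data.Product using (∃; _,_; _×_; proj₁; proj₂)
open import Data.Product.Properties using (≡-dec)
open import Data.Sum using (_⊎_; inj₁; inj₂)
open import Data.Unit using (⊤; tt)
open import Relation.Nullary using (¬_; yes; no; ¬?)
open import Relation.Nullary.Decidable using (dec-true; dec-false)
open import Relation.Binary.PropositionalEquality hiding ([_])
open import Relation.Binary.Bundles using (Setoid)
import Relation.Binary.Reasoning.Setoid
open import Function using (_∘_)

open DecMem (≡-dec _≟_ _≟_) using (_∈?_)

-- `m ≟ n` is implemented by `m ≡ᵇ n`, so `does (m ≟ n)` is `m ≡ᵇ n` on the nose.
≡ᵇ-≡ : ∀ {m n} → m ≡ n → (m ≡ᵇ n) ≡ true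
≡ᵇ-≡ {m} {n} = dec-true (m ≟ n)

≡ᵇ-≢ : ∀ {m n} → m ≢ n → (m ≡ᵇ n) ≡ false
≡ᵇ-≢ {m} {n} = dec-false (m ≟ n)

swapA-left : ∀ a b → swapA a b a ≡ b
swapA-left a b rewrite ≡ᵇ-≡ {a} refl = refl

swapA-right : ∀ a b → swapA a b b ≡ a
swapA-right a b with b ≟ a
... | yes refl = swapA-left a a
... | no b≢a rewrite ≡ᵇ-≢ b≢a | ≡ᵇ-≡ {b} refl = refl

swapA-other : ∀ {a b c} → c ≢ a → c ≢ b → swapA a b c ≡ c
swapA-other c≢a c≢b rewrite ≡ᵇ-≢ c≢a | ≡ᵇ-≢ c≢b = refl

swapA-involutive : ∀ a b c → swapA a b (swapA a b c) ≡ c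
swapA-involutive a b c with c ≟ a
... | yes refl rewrite swapA-left c b = swapA-right c b
... | no c≢a with c ≟ b
...   | yes refl rewrite swapA-right a c = swapA-left a c
...   | no c≢b rewrite swapA-other c≢a c≢b = swapA-other c≢a c≢b

swapA-preserves : ∀ (P : Atom → Set) {a b c} → P a → P b → P c → P (swapA a b c)
swapA-preserves P {a} {b} {c} pa pb pc with c ≡ᵇ a
... | true = pb
... | false with c ≡ᵇ b
...   | true = pa
...   | false = pc

permA-++ : ∀ π π' c → permA (π ++ π') c ≡ permA π (permA π' c)
permA-++ [] π' c = refl
permA-++ ((a , b) ∷ π) π' c = cong (swapA a b) (permA-++ π π' c)

permA-inverseˡ : ∀ π c → permA (inv π) (permA π c) ≡ c
permA-inverseˡ [] c = refl
permA-inverseˡ ((a , b) ∷ π) c = begin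
  permA (inv ((a , b) ∷ π)) (permA ((a , b) ∷ π) c)     ≡⟨ cong (λ ρ → permA ρ (swapA a b (permA π c))) (unfold-reverse (a , b) π) ⟩
  permA (inv π ++ [ (a , b) ]) (swapA a b (permA π c))  ≡⟨ permA-++ (inv π) [ (a , b) ] _ ⟩
  permA (inv π) (swapA a b (swapA a b (permA π c)))     ≡⟨ cong (permA (inv π)) (swapA-involutive a b (permA π c)) ⟩
  permA (inv π) (permA π c)                             ≡⟨ permA-inverseˡ π c ⟩
  c                                                     ∎
  where open ≡-Reasoning

permA-injective : ∀ π {x y} → permA π x ≡ permA π y → x ≡ y
permA-injective π {x} {y} e =
  trans (sym (permA-inverseˡ π x)) (trans (cong (permA (inv π)) e) (permA-inverseˡ π y))

permA-∈ : ∀ {as : List Atom} π {c} → (∀ {a} → a ∈ permAtoms π → a ∈ as) → c ∈ as → permA π c ∈ as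
permA-∈ [] _ c∈as = c∈as
permA-∈ {as} ((a , b) ∷ π) π⊆as c∈as =
  swapA-preserves (_∈ as) (π⊆as (here refl)) (π⊆as (there (here refl)))
    (permA-∈ π (λ a∈π → π⊆as (there (there a∈π))) c∈as)

mutual
  permT-id : ∀ u → permT [] u ≡ u
  permT-id (fn f ts) = cong (fn f) (permTs-id ts)
  permT-id (atm a) = refl
  permT-id (abs a u) = cong (abs a) (permT-id u)
  permT-id (sus π X) = refl

  permTs-id : ∀ ts → permTs [] ts ≡ ts
  permTs-id [] = refl
  permTs-id (t ∷ ts) = cong₂ _∷_ (permT-id t) (permTs-id ts)

-- Locally closed λ-terms

LC : ℕ → Λ → Set
LC k (bvar i) = i < k
LC k (fvar _) = ⊤
LC k (mvar _ _) = ⊤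
LC k (con _) = ⊤
LC k (app M N) = LC k M × LC k N
LC k (lam M) = LC (suc k) M

close-fvar-≡ : ∀ a d → close a d (fvar a) ≡ bvar d
close-fvar-≡ a d rewrite ≡ᵇ-≡ {a} refl = refl

close-fvar-≢ : ∀ {a c} d → c ≢ a → close a d (fvar c) ≡ fvar c
close-fvar-≢ d c≢a rewrite ≡ᵇ-≢ c≢a = refl

shift-LC : ∀ {k c} N → LC k N → k ≤ c → shift c N ≡ N
shift-LC {k} {c} (bvar i) i<k k≤c with i <ᵇ c in eq
... | true = refl
... | false = ⊥-elim (subst T eq (<⇒<ᵇ (<-≤-trans i<k k≤c)))
shift-LC (fvar _) _ _ = refl
shift-LC (mvar _ _) _ _ = refl
shift-LC (con _) _ _ = refl
shift-LC (app M N) (lcM , lcN) k≤c = cong₂ app (shift-LC M lcM k≤c) (shift-LC N lcN k≤c)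
shift-LC (lam M) lcM k≤c = cong lam (shift-LC M lcM (s≤s k≤c))

close-LC : ∀ {k} b N → LC k N → LC (suc k) (close b k N)
close-LC b (bvar i) i<k = m<n⇒m<1+n i<k
close-LC b (fvar c) _ with c ≡ᵇ b
... | true = s≤s ≤-refl
... | false = tt
close-LC b (mvar _ _) _ = tt
close-LC b (con _) _ = tt
close-LC b (app M N) (lcM , lcN) = close-LC b M lcM , close-LC b N lcN
close-LC b (lam M) lcM = close-LC b M lcM

apps-LC : ∀ {k} H Ms → LC k H → All (LC k) Ms → LC k (apps H Ms)
apps-LC H [] lcH [] = lcH
apps-LC H (M ∷ Ms) lcH (lcM ∷ lcMs) = apps-LC (app H M) Ms (lcH , lcM) lcMs

lams-LC : ∀ bs M → LC 0 M → LC 0 (lams bs M)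
lams-LC [] M lcM = lcM
lams-LC (b ∷ bs) M lcM = close-LC b (lams bs M) (lams-LC bs M lcM)

mutual
  ⟦⟧-LC : ∀ t as ∇ → LC 0 (⟦ t ⟧ as ∇)
  ⟦⟧-LC (fn f ts) as ∇ = apps-LC (con f) _ tt (⟦⟧s-LC ts as ∇)
  ⟦⟧-LC (atm a) as ∇ = tt
  ⟦⟧-LC (abs a t) as ∇ = close-LC a (⟦ t ⟧ as ∇) (⟦⟧-LC t as ∇)
  ⟦⟧-LC (sus π X) as ∇ = apps-LC (mvar X _) _ tt (fvars-LC (nonFresh as ∇ X))
    where
    fvars-LC : ∀ bs → All (LC 0) (map (λ b → fvar (permA π b)) bs)
    fvars-LC [] = []
    fvars-LC (b ∷ bs) = tt ∷ fvars-LC bs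

  ⟦⟧s-LC : ∀ ts as ∇ → All (LC 0) (⟦ ts ⟧s as ∇)
  ⟦⟧s-LC [] as ∇ = []
  ⟦⟧s-LC (t ∷ ts) as ∇ = ⟦⟧-LC t as ∇ ∷ ⟦⟧s-LC ts as ∇

data _∈FV_ (y : Atom) : Λ → Set where
  fv-fvar : y ∈FV fvar y
  fv-appˡ : ∀ {M N} → y ∈FV M → y ∈FV app M N
  fv-appʳ : ∀ {M N} → y ∈FV N → y ∈FV app M N
  fv-lam  : ∀ {M} → y ∈FV M → y ∈FV lam M

close-FV : ∀ {y a d} N → y ∈FV close a d N → y ≢ a × y ∈FV N
close-FV (bvar i) ()
close-FV {a = a} {d} (fvar c) y∈ with c ≟ a
... | yes refl rewrite close-fvar-≡ c d with () ← y∈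
... | no c≢a rewrite close-fvar-≢ d c≢a with fv-fvar ← y∈ = c≢a , fv-fvar
close-FV (mvar _ _) ()
close-FV (con _) ()
close-FV (app M N) (fv-appˡ y∈M) = let y≢a , y∈ = close-FV M y∈M in y≢a , fv-appˡ y∈
close-FV (app M N) (fv-appʳ y∈N) = let y≢a , y∈ = close-FV N y∈N in y≢a , fv-appʳ y∈
close-FV (lam M) (fv-lam y∈M) = let y≢a , y∈ = close-FV M y∈M in y≢a , fv-lam y∈

shift-FV : ∀ {y c} N → y ∈FV shift c N → y ∈FV N
shift-FV {c = c} (bvar i) y∈ with i <ᵇ c | y∈
... | true | ()
... | false | ()
shift-FV (fvar _) y∈ = y∈
shift-FV (mvar _ _) ()
shift-FV (con _) ()
shift-FV (app M N) (fv-appˡ y∈) = fv-appˡ (shift-FV M y∈)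
shift-FV (app M N) (fv-appʳ y∈) = fv-appʳ (shift-FV N y∈)
shift-FV (lam M) (fv-lam y∈) = fv-lam (shift-FV M y∈)

apps-FV : ∀ {y} H Ms → y ∈FV apps H Ms → y ∈FV H ⊎ Any (y ∈FV_) Ms
apps-FV H [] y∈ = inj₁ y∈
apps-FV H (M ∷ Ms) y∈ with apps-FV (app H M) Ms y∈
... | inj₁ (fv-appˡ y∈H) = inj₁ y∈H
... | inj₁ (fv-appʳ y∈M) = inj₂ (here y∈M)
... | inj₂ y∈Ms = inj₂ (there y∈Ms)

lams-FV : ∀ {y} bs M → y ∈FV lams bs M → y ∈FV M × y ∉ bs
lams-FV [] M y∈ = y∈ , λ ()
lams-FV (b ∷ bs) M (fv-lam y∈) with close-FV (lams bs M) y∈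
... | y≢b , y∈lams with lams-FV bs M y∈lams
...   | y∈M , y∉bs = y∈M , λ { (here y≡b) → y≢b y≡b ; (there y∈bs) → y∉bs y∈bs }

fvars-FV : ∀ {y} (g : Atom → Atom) bs → Any (y ∈FV_) (map (λ b → fvar (g b)) bs) → ∃ λ b → b ∈ bs × y ≡ g b
fvars-FV g bs y∈ with find (map⁻ y∈)
... | b , b∈bs , fv-fvar = b , b∈bs , refl

∈-nonFresh⁻ : ∀ {as ∇ X b} → b ∈ nonFresh as ∇ X → b ∈ as × (b , X) ∉ ∇
∈-nonFresh⁻ {as} {∇} {X} = ∈-filter⁻ (λ a → ¬? ((a , X) ∈? ∇)) {xs = as}

∈-nonFresh⁺ : ∀ {as ∇ X b} → b ∈ as → (b , X) ∉ ∇ → b ∈ nonFresh as ∇ X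
∈-nonFresh⁺ {∇ = ∇} {X} = ∈-filter⁺ (λ a → ¬? ((a , X) ∈? ∇))

mutual
  ⟦⟧-FV-∈ : ∀ {y} as ∇ t → (∀ {a} → a ∈ atomsT t → a ∈ as) → y ∈FV ⟦ t ⟧ as ∇ → y ∈ as
  ⟦⟧-FV-∈ as ∇ (fn f ts) t⊆as y∈ with apps-FV (con f) _ y∈
  ... | inj₂ y∈ts = ⟦⟧s-FV-∈ as ∇ ts t⊆as y∈ts
  ⟦⟧-FV-∈ as ∇ (atm a) t⊆as fv-fvar = t⊆as (here refl)
  ⟦⟧-FV-∈ as ∇ (abs a t) t⊆as (fv-lam y∈) =
    ⟦⟧-FV-∈ as ∇ t (λ a∈t → t⊆as (there a∈t)) (proj₂ (close-FV (⟦ t ⟧ as ∇) y∈))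
  ⟦⟧-FV-∈ as ∇ (sus π X) t⊆as y∈ with apps-FV (mvar X _) _ y∈
  ... | inj₂ y∈args with fvars-FV (permA π) (nonFresh as ∇ X) y∈args
  ...   | b , b∈bs , refl = permA-∈ π t⊆as (proj₁ (∈-nonFresh⁻ {as} {∇} {X} b∈bs))

  ⟦⟧s-FV-∈ : ∀ {y} as ∇ ts → (∀ {a} → a ∈ atomsTs ts → a ∈ as) → Any (y ∈FV_) (⟦ ts ⟧s as ∇) → y ∈ as
  ⟦⟧s-FV-∈ as ∇ (t ∷ ts) ts⊆as (here y∈) = ⟦⟧-FV-∈ as ∇ t (λ a∈ → ts⊆as (∈-++⁺ˡ a∈)) y∈
  ⟦⟧s-FV-∈ as ∇ (t ∷ ts) ts⊆as (there y∈) = ⟦⟧s-FV-∈ as ∇ ts (λ a∈ → ts⊆as (∈-++⁺ʳ (atomsT t) a∈)) y∈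

mutual
  #⇒∉FV⟦⟧ : ∀ {y} as ∇ t → ∇ ⊢ y # t → ¬ y ∈FV ⟦ t ⟧ as ∇
  #⇒∉FV⟦⟧ as ∇ (fn f ts) (#fn y#ts) y∈ with apps-FV (con f) _ y∈
  ... | inj₂ y∈ts = #⇒∉FV⟦⟧s as ∇ ts y#ts y∈ts
  #⇒∉FV⟦⟧ as ∇ (atm a) (#atm y≢a) fv-fvar = y≢a refl
  #⇒∉FV⟦⟧ as ∇ (abs a t) #abs= (fv-lam y∈) = proj₁ (close-FV (⟦ t ⟧ as ∇) y∈) refl
  #⇒∉FV⟦⟧ as ∇ (abs a t) (#abs _ y#t) (fv-lam y∈) = #⇒∉FV⟦⟧ as ∇ t y#t (proj₂ (close-FV (⟦ t ⟧ as ∇) y∈))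
  #⇒∉FV⟦⟧ as ∇ (sus π X) (#sus y#X) y∈ with apps-FV (mvar X _) _ y∈
  ... | inj₂ y∈args with fvars-FV (permA π) (nonFresh as ∇ X) y∈args
  ...   | b , b∈bs , refl = proj₂ (∈-nonFresh⁻ {as} {∇} {X} b∈bs) (subst (λ c → (c , X) ∈ ∇) (permA-inverseˡ π b) y#X)

  #⇒∉FV⟦⟧s : ∀ {y} as ∇ ts → All (λ t → ∇ ⊢ y # t) ts → ¬ Any (y ∈FV_) (⟦ ts ⟧s as ∇)
  #⇒∉FV⟦⟧s as ∇ (t ∷ ts) (y#t ∷ _) (here y∈) = #⇒∉FV⟦⟧ as ∇ t y#t y∈
  #⇒∉FV⟦⟧s as ∇ (t ∷ ts) (_ ∷ y#ts) (there y∈) = #⇒∉FV⟦⟧s as ∇ ts y#ts y∈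

≡⇒≈βη : ∀ {M N} → M ≡ N → M ≈βη N
≡⇒≈βη refl = ≈refl

≈βη-setoid : Setoid _ _
≈βη-setoid = record
  { Carrier = Λ
  ; _≈_ = _≈βη_
  ; isEquivalence = record { refl = ≈refl ; sym = ≈sym ; trans = ≈trans }
  }

apps-cong : ∀ {H H' Ms Ms'} → H ≈βη H' → Pointwise _≈βη_ Ms Ms' → apps H Ms ≈βη apps H' Ms'
apps-cong H≈H' [] = H≈H'
apps-cong H≈H' (M≈M' ∷ Ms≈Ms') = apps-cong (app-cong H≈H' M≈M') Ms≈Ms'

close-shift : ∀ a {c e} M → c ≤ e → close a (suc e) (shift c M) ≡ shift c (close a e M)
close-shift a {c} (bvar i) c≤e with i <ᵇ c
... | true = refl
... | false = refl
close-shift a {c} {e} (fvar x) c≤e with x ≡ᵇ a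
... | false = refl
... | true with e <ᵇ c in eq
...   | false = refl
...   | true = ⊥-elim (<-irrefl refl (<-≤-trans (<ᵇ⇒< e c (subst T (sym eq) tt)) c≤e))
close-shift a (mvar _ _) c≤e = refl
close-shift a (con _) c≤e = refl
close-shift a (app M N) c≤e = cong₂ app (close-shift a M c≤e) (close-shift a N c≤e)
close-shift a (lam M) c≤e = cong lam (close-shift a M (s≤s c≤e))

sub-var-above : ∀ k d N → sub-var k (suc (k + d)) N ≡ bvar (k + d)
sub-var-above zero d N = refl
sub-var-above (suc k) d N rewrite sub-var-above k d N = refl

close-sub-var : ∀ a k d i N → close a (k + d) (sub-var k i N) ≡ sub-var k i (close a d N)
close-sub-var a zero d zero N = refl
close-sub-var a zero d (suc i) N = refl
close-sub-var a (suc k) d zero N = refl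
close-sub-var a (suc k) d (suc i) N
  rewrite close-shift a {0} {k + d} (sub-var k i N) z≤n = cong (shift 0) (close-sub-var a k d i N)

close-sub : ∀ a k d N M → close a (k + d) (sub k N M) ≡ sub k (close a d N) (close a (suc (k + d)) M)
close-sub a k d N (bvar i) = close-sub-var a k d i N
close-sub a k d N (fvar c) with c ≡ᵇ a
... | true = sym (sub-var-above k d (close a d N))
... | false = refl
close-sub a k d N (mvar _ _) = refl
close-sub a k d N (con _) = refl
close-sub a k d N (app M M') = cong₂ app (close-sub a k d N M) (close-sub a k d N M')
close-sub a k d N (lam M) = cong lam (close-sub a (suc k) d N M)

close-cong : ∀ a d {M N} → M ≈βη N → close a d M ≈βη close a d N
close-cong a d (β {M} {N}) = ≈trans β (≡⇒≈βη (sym (close-sub a 0 d N M)))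
close-cong a d (η {M}) rewrite close-shift a {0} {d} M z≤n = η
close-cong a d ≈refl = ≈refl
close-cong a d (≈sym M≈N) = ≈sym (close-cong a d M≈N)
close-cong a d (≈trans M≈N N≈P) = ≈trans (close-cong a d M≈N) (close-cong a d N≈P)
close-cong a d (app-cong M≈M' N≈N') = app-cong (close-cong a d M≈M') (close-cong a d N≈N')
close-cong a d (lam-cong M≈M') = lam-cong (close-cong a (suc d) M≈M')

sub-var-self : ∀ k b → sub-var k k (fvar b) ≡ fvar b
sub-var-self zero b = refl
sub-var-self (suc k) b rewrite sub-var-self k b = refl

sub-var-below : ∀ k i N → i < k → sub-var k i N ≡ bvar i
sub-var-below (suc k) zero N _ = refl
sub-var-below (suc k) (suc i) N (s≤s i<k) rewrite sub-var-below k i N i<k = refl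

sub-close : ∀ {k} b N → LC k N → sub k (fvar b) (close b k N) ≡ N
sub-close {k} b (bvar i) i<k = sub-var-below k i (fvar b) i<k
sub-close {k} b (fvar c) _ with c ≟ b
... | yes refl rewrite close-fvar-≡ c k = sub-var-self k c
... | no c≢b rewrite close-fvar-≢ k c≢b = refl
sub-close b (mvar _ _) _ = refl
sub-close b (con _) _ = refl
sub-close b (app M N) (lcM , lcN) = cong₂ app (sub-close b M lcM) (sub-close b N lcN)
sub-close b (lam M) lcM = cong lam (sub-close b M lcM)

β-lams : ∀ bs M → LC 0 M → apps (lams bs M) (map fvar bs) ≈βη M
β-lams [] M lcM = ≈refl
β-lams (b ∷ bs) M lcM =
  ≈trans (apps-cong {Ms = map fvar bs} β-head (Pointwise.refl ≈refl)) (β-lams bs M lcM)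
  where
  β-head : app (lams (b ∷ bs) M) (fvar b) ≈βη lams bs M
  β-head = ≈trans β (≡⇒≈βη (sub-close b (lams bs M) (lams-LC bs M lcM)))

-- Renaming of free atoms

rename : (Atom → Atom) → Λ → Λ
rename g (bvar i) = bvar i
rename g (fvar a) = fvar (g a)
rename g (mvar X m) = mvar X m
rename g (con f) = con f
rename g (app M N) = app (rename g M) (rename g N)
rename g (lam M) = lam (rename g M)

rename-shift : ∀ g c M → rename g (shift c M) ≡ shift c (rename g M)
rename-shift g c (bvar i) with i <ᵇ c
... | true = refl
... | false = refl
rename-shift g c (fvar _) = refl
rename-shift g c (mvar _ _) = refl
rename-shift g c (con _) = refl
rename-shift g c (app M N) = cong₂ app (rename-shift g c M) (rename-shift g c N)
rename-shift g c (lam M) = cong lam (rename-shift g (suc c) M)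

rename-sub-var : ∀ g k i N → rename g (sub-var k i N) ≡ sub-var k i (rename g N)
rename-sub-var g zero zero N = refl
rename-sub-var g zero (suc i) N = refl
rename-sub-var g (suc k) zero N = refl
rename-sub-var g (suc k) (suc i) N
  rewrite rename-shift g 0 (sub-var k i N) = cong (shift 0) (rename-sub-var g k i N)

rename-sub : ∀ g k N M → rename g (sub k N M) ≡ sub k (rename g N) (rename g M)
rename-sub g k N (bvar i) = rename-sub-var g k i N
rename-sub g k N (fvar _) = refl
rename-sub g k N (mvar _ _) = refl
rename-sub g k N (con _) = refl
rename-sub g k N (app M M') = cong₂ app (rename-sub g k N M) (rename-sub g k N M')
rename-sub g k N (lam M) = cong lam (rename-sub g (suc k) N M)

rename-cong : ∀ g {M N} → M ≈βη N → rename g M ≈βη rename g N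
rename-cong g (β {M} {N}) = ≈trans β (≡⇒≈βη (sym (rename-sub g 0 N M)))
rename-cong g (η {M}) rewrite rename-shift g 0 M = η
rename-cong g ≈refl = ≈refl
rename-cong g (≈sym M≈N) = ≈sym (rename-cong g M≈N)
rename-cong g (≈trans M≈N N≈P) = ≈trans (rename-cong g M≈N) (rename-cong g N≈P)
rename-cong g (app-cong M≈M' N≈N') = app-cong (rename-cong g M≈M') (rename-cong g N≈N')
rename-cong g (lam-cong M≈M') = lam-cong (rename-cong g M≈M')

rename-apps : ∀ g H Ms → rename g (apps H Ms) ≡ apps (rename g H) (map (rename g) Ms)
rename-apps g H [] = refl
rename-apps g H (M ∷ Ms) = rename-apps g (app H M) Ms

rename-∉FV : ∀ g N → (∀ {y} → ¬ y ∈FV N) → rename g N ≡ N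
rename-∉FV g (bvar _) _ = refl
rename-∉FV g (fvar _) ∉FV = ⊥-elim (∉FV fv-fvar)
rename-∉FV g (mvar _ _) _ = refl
rename-∉FV g (con _) _ = refl
rename-∉FV g (app M N) ∉FV =
  cong₂ app (rename-∉FV g M (λ y∈ → ∉FV (fv-appˡ y∈))) (rename-∉FV g N (λ y∈ → ∉FV (fv-appʳ y∈)))
rename-∉FV g (lam M) ∉FV = cong lam (rename-∉FV g M (λ y∈ → ∉FV (fv-lam y∈)))

rename-close : ∀ g → (∀ {x y} → g x ≡ g y → x ≡ y) → ∀ a d N → rename g (close a d N) ≡ close (g a) d (rename g N)
rename-close g inj a d (bvar _) = refl
rename-close g inj a d (fvar c) with c ≟ a
... | yes refl rewrite close-fvar-≡ c d | close-fvar-≡ (g c) d = refl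
... | no c≢a rewrite close-fvar-≢ d c≢a | close-fvar-≢ d (λ gc≡ga → c≢a (inj gc≡ga)) = refl
rename-close g inj a d (mvar _ _) = refl
rename-close g inj a d (con _) = refl
rename-close g inj a d (app M N) = cong₂ app (rename-close g inj a d M) (rename-close g inj a d N)
rename-close g inj a d (lam M) = cong lam (rename-close g inj a (suc d) M)

mutual
  ⟦permT⟧ : ∀ π u as ∇ → ⟦ permT π u ⟧ as ∇ ≡ rename (permA π) (⟦ u ⟧ as ∇)
  ⟦permT⟧ π (fn f ts) as ∇ =
    trans (cong (apps (con f)) (⟦permTs⟧ π ts as ∇)) (sym (rename-apps (permA π) (con f) (⟦ ts ⟧s as ∇)))
  ⟦permT⟧ π (atm a) as ∇ = refl
  ⟦permT⟧ π (abs a t) as ∇ =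
    trans (cong (λ M → lam (close (permA π a) 0 M)) (⟦permT⟧ π t as ∇))
          (cong lam (sym (rename-close (permA π) (permA-injective π) a 0 (⟦ t ⟧ as ∇))))
  ⟦permT⟧ π (sus π' X) as ∇ =
    trans (cong (apps (mvar X (length bs))) (trans (map-cong (λ b → cong fvar (permA-++ π π' b)) bs) (map-∘ bs)))
          (sym (rename-apps (permA π) (mvar X (length bs)) (map (λ b → fvar (permA π' b)) bs)))
    where bs = nonFresh as ∇ X

  ⟦permTs⟧ : ∀ π ts as ∇ → ⟦ permTs π ts ⟧s as ∇ ≡ map (rename (permA π)) (⟦ ts ⟧s as ∇)
  ⟦permTs⟧ π [] as ∇ = refl
  ⟦permTs⟧ π (t ∷ ts) as ∇ = cong₂ _∷_ (⟦permT⟧ π t as ∇) (⟦permTs⟧ π ts as ∇)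

-- Meta-substitutions with closed images

record Closed (M : Λ) : Set where
  field
    lc  : LC 0 M
    ∉FV : ∀ {y} → ¬ y ∈FV M

ClosedImages : MSubst → Set
ClosedImages ρ = ∀ {X m L} → ρ X m ≡ just L → Closed L

msub-apps : ∀ ρ H Ms → msub ρ (apps H Ms) ≡ apps (msub ρ H) (map (msub ρ) Ms)
msub-apps ρ H [] = refl
msub-apps ρ H (M ∷ Ms) = msub-apps ρ (app H M) Ms

msub-≗ : ∀ ρ ρ' N → (∀ X m → ρ X m ≡ ρ' X m) → msub ρ N ≡ msub ρ' N
msub-≗ ρ ρ' (bvar _) _ = refl
msub-≗ ρ ρ' (fvar _) _ = refl
msub-≗ ρ ρ' (mvar X m) ρ≗ρ' = cong (maybe′ (λ L → L) (mvar X m)) (ρ≗ρ' X m)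
msub-≗ ρ ρ' (con _) _ = refl
msub-≗ ρ ρ' (app M N) ρ≗ρ' = cong₂ app (msub-≗ ρ ρ' M ρ≗ρ') (msub-≗ ρ ρ' N ρ≗ρ')
msub-≗ ρ ρ' (lam M) ρ≗ρ' = cong lam (msub-≗ _ _ M (λ X m → cong (Maybe.map (shift 0)) (ρ≗ρ' X m)))

close-∉FV : ∀ a d L → ¬ a ∈FV L → close a d L ≡ L
close-∉FV a d (bvar _) _ = refl
close-∉FV a d (fvar c) a∉L with c ≟ a
... | yes refl = ⊥-elim (a∉L fv-fvar)
... | no c≢a = close-fvar-≢ d c≢a
close-∉FV a d (mvar _ _) _ = refl
close-∉FV a d (con _) _ = refl
close-∉FV a d (app M N) a∉L =
  cong₂ app (close-∉FV a d M (λ a∈ → a∉L (fv-appˡ a∈))) (close-∉FV a d N (λ a∈ → a∉L (fv-appʳ a∈)))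
close-∉FV a d (lam M) a∉L = cong lam (close-∉FV a (suc d) M (λ a∈ → a∉L (fv-lam a∈)))

msub-close : ∀ ρ a d N → (∀ {X m L} → ρ X m ≡ just L → ¬ a ∈FV L) → msub ρ (close a d N) ≡ close a d (msub ρ N)
msub-close ρ a d (bvar _) _ = refl
msub-close ρ a d (fvar c) _ with c ≡ᵇ a
... | true = refl
... | false = refl
msub-close ρ a d (mvar X m) a∉ρ with ρ X m in eq
... | nothing = refl
... | just L = sym (close-∉FV a d L (a∉ρ eq))
msub-close ρ a d (con _) _ = refl
msub-close ρ a d (app M N) a∉ρ = cong₂ app (msub-close ρ a d M a∉ρ) (msub-close ρ a d N a∉ρ)
msub-close ρ a d (lam M) a∉ρ = cong lam (msub-close _ a (suc d) M a∉ρ↑)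
  where
  a∉ρ↑ : ∀ {X m L} → Maybe.map (shift 0) (ρ X m) ≡ just L → ¬ a ∈FV L
  a∉ρ↑ {X} {m} e with ρ X m in eq
  a∉ρ↑ {X} {m} refl | just L = λ a∈ → a∉ρ eq (shift-FV L a∈)

msub-lam : ∀ ρ → ClosedImages ρ → ∀ M → msub ρ (lam M) ≡ lam (msub ρ M)
msub-lam ρ closed M = cong lam (msub-≗ _ ρ M shift-image)
  where
  shift-image : ∀ X m → Maybe.map (shift 0) (ρ X m) ≡ ρ X m
  shift-image X m with ρ X m in eq
  ... | nothing = refl
  ... | just L = cong just (shift-LC L (Closed.lc (closed eq)) z≤n)

applyS-sus : ∀ σ π X {u} → σ X ≡ just u → applyS σ (sus π X) ≡ permT π u
applyS-sus σ π X σX≡u = cong (maybe′ (permT π) (sus π X)) σX≡u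

module _ (as : List Atom) (σ : Subst) (∇₁ ∇₂ : FEnv)
         (σ⊆as : ∀ {X u a} → σ X ≡ just u → a ∈ atomsT u → a ∈ as)
         (∇₂⊢σ∇₁ : ∇₂ ⊢σ σ ⟨ ∇₁ ⟩) where

  private
    ρ : MSubst
    ρ = ⟦ σ ⟧σ as ∇₁ ∇₂

    bs : Var → List Atom
    bs X = nonFresh as ∇₁ X

  open Relation.Binary.Reasoning.Setoid ≈βη-setoid

  ⟦σ⟧σ-just : ∀ {X m L} → ρ X m ≡ just L → ∃ λ u → σ X ≡ just u × L ≡ lams (bs X) (⟦ u ⟧ as ∇₂)
  ⟦σ⟧σ-just {X} {m} e with σ X
  ... | just u with m ≡ᵇ length (bs X)
  ...   | true with refl ← e = u , refl , refl

  ⟦σ⟧σ-dom : ∀ {X u} → σ X ≡ just u → ρ X (length (bs X)) ≡ just (lams (bs X) (⟦ u ⟧ as ∇₂))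
  ⟦σ⟧σ-dom {X} σX≡u with σ X
  ⟦σ⟧σ-dom {X} refl | just u rewrite ≡ᵇ-≡ {length (bs X)} refl = refl

  ⟦σ⟧σ-image-closed : ∀ {X u} → σ X ≡ just u → Closed (lams (bs X) (⟦ u ⟧ as ∇₂))
  ⟦σ⟧σ-image-closed {X} {u} σX≡u = record { lc = lams-LC (bs X) _ (⟦⟧-LC u as ∇₂) ; ∉FV = ∉FV }
    where
    ∉FV : ∀ {y} → ¬ y ∈FV lams (bs X) (⟦ u ⟧ as ∇₂)
    ∉FV {y} y∈ with lams-FV (bs X) _ y∈ | (y , X) ∈? ∇₁
    ... | y∈⟦u⟧ , y∉bs | no y#X∉∇₁ = y∉bs (∈-nonFresh⁺ (⟦⟧-FV-∈ as ∇₂ u (σ⊆as σX≡u) y∈⟦u⟧) y#X∉∇₁)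
    ... | y∈⟦u⟧ , _ | yes y#X∈∇₁ =
      #⇒∉FV⟦⟧ as ∇₂ u (subst (∇₂ ⊢ y #_) (trans (applyS-sus σ [] X σX≡u) (permT-id u)) (∇₂⊢σ∇₁ y#X∈∇₁)) y∈⟦u⟧

  ⟦σ⟧σ-closed : ClosedImages ρ
  ⟦σ⟧σ-closed e with ⟦σ⟧σ-just e
  ... | u , σX≡u , refl = ⟦σ⟧σ-image-closed σX≡u

  ⟦σ⟧σ-sus : ∀ π {X u} → σ X ≡ just u → msub ρ (⟦ sus π X ⟧ as ∇₁) ≈βη ⟦ applyS σ (sus π X) ⟧ as ∇₂
  ⟦σ⟧σ-sus π {X} {u} σX≡u = begin
    msub ρ (apps (mvar X (length (bs X))) (map (fvar ∘ g) (bs X)))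
      ≡⟨ msub-apps ρ _ (map (fvar ∘ g) (bs X)) ⟩
    apps (maybe′ (λ L → L) (mvar X (length (bs X))) (ρ X (length (bs X)))) (map (msub ρ) (map (fvar ∘ g) (bs X)))
      ≡⟨ cong₂ apps (cong (maybe′ (λ L → L) _) (⟦σ⟧σ-dom σX≡u)) (sym (map-∘ (bs X))) ⟩
    apps (lams (bs X) M) (map (fvar ∘ g) (bs X))
      ≡⟨ cong₂ apps (sym (rename-∉FV g _ (Closed.∉FV (⟦σ⟧σ-image-closed σX≡u)))) (map-∘ (bs X)) ⟩
    apps (rename g (lams (bs X) M)) (map (rename g) (map fvar (bs X)))
      ≡⟨ rename-apps g (lams (bs X) M) (map fvar (bs X)) ⟨
    rename g (apps (lams (bs X) M) (map fvar (bs X)))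
      ≈⟨ rename-cong g (β-lams (bs X) M (⟦⟧-LC u as ∇₂)) ⟩
    rename g M
      ≡⟨ ⟦permT⟧ π u as ∇₂ ⟨
    ⟦ permT π u ⟧ as ∇₂
      ≡⟨ cong (λ v → ⟦ v ⟧ as ∇₂) (applyS-sus σ π X σX≡u) ⟨
    ⟦ applyS σ (sus π X) ⟧ as ∇₂ ∎
    where
    g : Atom → Atom
    g = permA π
    M : Λ
    M = ⟦ u ⟧ as ∇₂

  mutual
    ⟦σ⟧σ-commutes : ∀ t → (∀ {X} → X ∈ varsT t → ∃ λ u → σ X ≡ just u)
                  → msub ρ (⟦ t ⟧ as ∇₁) ≈βη ⟦ applyS σ t ⟧ as ∇₂
    ⟦σ⟧σ-commutes (fn f ts) t⊆σ =
      ≈trans (≡⇒≈βη (msub-apps ρ (con f) (⟦ ts ⟧s as ∇₁))) (apps-cong ≈refl (⟦σ⟧σ-commutesₛ ts t⊆σ))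
    ⟦σ⟧σ-commutes (atm a) _ = ≈refl
    ⟦σ⟧σ-commutes (abs a t) t⊆σ = begin
      msub ρ (lam (close a 0 (⟦ t ⟧ as ∇₁)))
        ≡⟨ msub-lam ρ ⟦σ⟧σ-closed (close a 0 (⟦ t ⟧ as ∇₁)) ⟩
      lam (msub ρ (close a 0 (⟦ t ⟧ as ∇₁)))
        ≡⟨ cong lam (msub-close ρ a 0 (⟦ t ⟧ as ∇₁) (λ e → Closed.∉FV (⟦σ⟧σ-closed e))) ⟩
      lam (close a 0 (msub ρ (⟦ t ⟧ as ∇₁)))
        ≈⟨ lam-cong (close-cong a 0 (⟦σ⟧σ-commutes t t⊆σ)) ⟩
      lam (close a 0 (⟦ applyS σ t ⟧ as ∇₂)) ∎
    ⟦σ⟧σ-commutes (sus π X) t⊆σ = ⟦σ⟧σ-sus π (proj₂ (t⊆σ (here refl)))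

    ⟦σ⟧σ-commutesₛ : ∀ ts → (∀ {X} → X ∈ varsTs ts → ∃ λ u → σ X ≡ just u)
                   → Pointwise _≈βη_ (map (msub ρ) (⟦ ts ⟧s as ∇₁)) (⟦ applySs σ ts ⟧s as ∇₂)
    ⟦σ⟧σ-commutesₛ [] _ = []
    ⟦σ⟧σ-commutesₛ (t ∷ ts) ts⊆σ =
      ⟦σ⟧σ-commutes t (λ X∈ → ts⊆σ (∈-++⁺ˡ X∈)) ∷ ⟦σ⟧σ-commutesₛ ts (λ X∈ → ts⊆σ (∈-++⁺ʳ (varsT t) X∈))

lemma8p2 : (as : List Atom) → Unique as
    → (σ : Subst) (∇₁ ∇₂ : FEnv) (t : Term)
    → (∀ {a} → a ∈ atomsT t → a ∈ as)
    → (∀ {X u a} → σ X ≡ just u → a ∈ atomsT u → a ∈ as)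
    → (∀ {a X} → (a , X) ∈ ∇₁ → a ∈ as)
    → (∀ {a X} → (a , X) ∈ ∇₂ → a ∈ as)
    → ∇₂ ⊢σ σ ⟨ ∇₁ ⟩
    → (∀ {X} → X ∈ varsT t → ∃ λ u → σ X ≡ just u)
    → msub (⟦ σ ⟧σ as ∇₁ ∇₂) (⟦ t ⟧ as ∇₁) ≈βη ⟦ applyS σ t ⟧ as ∇₂
lemma8p2 as _ σ ∇₁ ∇₂ t _ σ⊆as _ _ ∇₂⊢σ∇₁ t⊆σ = ⟦σ⟧σ-commutes as σ ∇₁ ∇₂ σ⊆as ∇₂⊢σ∇₁ t t⊆σ
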